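{- Let $\pi$ be a permutation of rank $n$ with augmented non-inversion zone-crossing vector $(a_0,a_1,\dots,a_{n-1},a_n)$. For $0\le k\le n$, let $\rho$ be the permutation of rank $n+1$ obtained by inserting the value $n+1$ into $\pi$ between positions $k$ and $k+1$ (so $\rho=\pi_1\cdots\pi_k\,(n+1)\,\pi_{k+1}\cdots\pi_n$; for $k=0$ this is $(n+1)\pi_1\cdots\pi_n$). Then the augmented non-inversion zone-crossing vector of $\rho$ is \[(a_0+0,\,a_1+1,\,a_2+2,\,\dots,\,a_k+k,\,a_k,\,a_{k+1},\,\dots,\,a_n).\]
   Context: A permutation of rank $n$ is a bijection $\pi$ of $\{1,\dots,n\}$. A non-inversion of $\pi$ is a pair $(a,b)$ with $1\le a<b\le n$ and $\pi(a)<\pi(b)$. The non-inversion zone-crossing vector of $\pi$ is $(z_1,\dots,z_{n-1})$, where $z_k$ is the number of non-inversions $(a,b)$ with $a\le k<b$, and the augmented vector is $(0,z_1,\dots,z_{n-1},0)$, indexed $0,\dots,n$. -}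

module Defs where

open import Data.Nat using (ℕ; zero; suc; _≤?_; _<?_; _≟_)
open import Data.Fin using (Fin; toℕ)
import Data.Fin as F
open import Data.Fin.Permutation using (Permutation′; _⟨$⟩ʳ_)
open import Data.List using (List; length; filter; map; cartesianProduct; allFin; upTo)
open import Data.Product using (_×_; _,_)
open import Relation.Nullary.Decidable using (_×-dec_; _⊎-dec_)
open import Data.Bool using (if_then_else_)
open import Relation.Nullary.Decidable using (⌊_⌋)

-- Permutations of rank n are bijections of Fin n (0-based: position/value i+1
-- of the paper is Fin index i).

-- z π k : number of non-inversions (a,b), i.e. a < b and π a < π b, with
-- a ≤ k < b in 1-based positions; 0-based indices a', b' satisfy a' < k ≤ b'
-- (which already forces a' < b').
zoneCrossing : {n : ℕ} → Permutation′ n → ℕ → ℕ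
zoneCrossing {n} π k =
  length (filter (λ { (a , b) → (toℕ a <? k) ×-dec ((k ≤? toℕ b) ×-dec ((π ⟨$⟩ʳ a) F.<? (π ⟨$⟩ʳ b))) })
                 (cartesianProduct (allFin n) (allFin n)))

augmented : {n : ℕ} → Permutation′ n → List ℕ
augmented {n} π =
  map (λ i → if ⌊ (i ≟ 0) ⊎-dec (i ≟ n) ⌋ then 0 else zoneCrossing π i) (upTo (suc n))

-- insertion of the value n+1 (Fin index n = fromℕ n) at position k (0-based:
-- exactly k entries of π precede it).  Permutation.insert k j π sends k ↦ j and
-- punchIn k i ↦ punchIn j (π i); with j = fromℕ n, punchIn j = inject₁.
insertMax : {n : ℕ} → Fin (suc n) → Permutation′ n → Permutation′ (suc n)
insertMax {n} k π = Data.Fin.Permutation.insert k (F.fromℕ n) π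

-- Write ρ for π with the maximal value inserted at position k.  Every entry of
-- ρ other than the new one sits at punchIn k x for a position x of π, and ρ
-- compares these entries exactly as π does; the new entry is the largest, so it
-- is the larger end of a non-inversion (a, k) for every a < k and the smaller
-- end of none.  A cut of ρ at c ≤ k therefore separates the pairs separated by
-- the cut of π at c, plus the c pairs (a, k) with a < c; a cut of ρ at c + 1 > k
-- separates exactly the pairs separated by the cut of π at c.
module Submission where

open import Defs
open import Data.Nat using (ℕ; zero; suc; _+_; _≤_; _<_; _≤?_; _<?_; _≟_; z≤n; s≤s; s<s; s≤s⁻¹; s<s⁻¹)
open import Data.Nat.Properties
  using (+-0-commutativeMonoid; +-comm; ≤-trans; <-≤-trans; ≤⇒≯; ≮⇒≥; m<n⇒m<1+n; n≤1+n)
open import Data.Fin using (Fin; toℕ; punchIn; fromℕ)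
import Data.Fin as F
open import Data.Fin.Properties using (toℕ<n; toℕ-fromℕ)
open import Data.Fin.Permutation using (Permutation′; _⟨$⟩ʳ_; insert; insert-punchIn)
open import Data.List using (List; _∷_; length; filter; map; cartesianProduct; tabulate; applyUpTo; upTo; _++_; zipWith; take; drop)
open import Data.List.Properties using (filter-++; length-++; map-tabulate; map-cong; map-upTo)
open import Data.Bool using (true; false; if_then_else_)
open import Data.Product using (_×_; _,_)
open import Data.Product.Function.NonDependent.Propositional using (_×-⇔_)
open import Function using (_∘_; _⇔_; mk⇔; module Equivalence)
import Function.Properties.Equivalence as ⇔
open import Relation.Nullary using (Dec; does; ¬_; yes; no; contradiction)
open import Relation.Nullary.Decidable using (⌊_⌋; _×-dec_; _⊎-dec_; does-⇔; dec-false)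
open import Relation.Unary using (Pred; Decidable)
open import Relation.Binary.PropositionalEquality
open import Algebra.Properties.CommutativeMonoid.Sum +-0-commutativeMonoid
  using (sum; sum-syntax; sum-remove; ∑-distrib-+; sum-cong-≗; sum-replicate-zero)

open ≡-Reasoning

𝟙[_] : ∀ {p} {P : Set p} → Dec P → ℕ
𝟙[ P? ] = if does P? then 1 else 0

𝟙-⇔ : ∀ {p q} {P : Set p} {Q : Set q} → P ⇔ Q → (P? : Dec P) (Q? : Dec Q) → 𝟙[ P? ] ≡ 𝟙[ Q? ]
𝟙-⇔ P⇔Q P? Q? = cong (λ b → if b then 1 else 0) (does-⇔ P⇔Q P? Q?)

𝟙-reject : ∀ {p} {P : Set p} (P? : Dec P) → ¬ P → 𝟙[ P? ] ≡ 0
𝟙-reject P? ¬P = cong (λ b → if b then 1 else 0) (dec-false P? ¬P)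

-- Sums are folds on the size, which Agda cannot invert, so below the size of a
-- sum is often passed explicitly to let the summand be inferred.
sum-zero : ∀ {n} (f : Fin n → ℕ) → (∀ i → f i ≡ 0) → sum f ≡ 0
sum-zero {n} f f≗0 = trans (sum-cong-≗ f≗0) (sum-replicate-zero n)

∑-𝟙-toℕ< : ∀ {n} c → c ≤ n → ∑[ x < n ] 𝟙[ toℕ x <? c ] ≡ c
∑-𝟙-toℕ< {n} zero _ = sum-zero {n} _ (λ x → 𝟙-reject (toℕ x <? 0) λ ())
∑-𝟙-toℕ< {suc n} (suc c) c<n = cong suc (begin
  ∑[ x < n ] 𝟙[ suc (toℕ x) <? suc c ] ≡⟨ sum-cong-≗ {n} (λ x → 𝟙-⇔ (mk⇔ s<s⁻¹ s<s) (suc (toℕ x) <? suc c) (toℕ x <? c)) ⟩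
  ∑[ x < n ] 𝟙[ toℕ x <? c ]           ≡⟨ ∑-𝟙-toℕ< c (s≤s⁻¹ c<n) ⟩
  c                                    ∎)

module _ {a p} {A : Set a} {P : Pred A p} (P? : Decidable P) where

  length-filter-tabulate : ∀ {n} (f : Fin n → A) → length (filter P? (tabulate f)) ≡ ∑[ i < n ] 𝟙[ P? (f i) ]
  length-filter-tabulate {zero} f = refl
  length-filter-tabulate {suc n} f with does (P? (f F.zero))
  ... | true  = cong suc (length-filter-tabulate (f ∘ F.suc))
  ... | false = length-filter-tabulate (f ∘ F.suc)

module _ {a b p} {A : Set a} {B : Set b} {P : Pred (A × B) p} (P? : Decidable P) where

  length-filter-cartesianProduct-tabulate : ∀ {m n} (f : Fin m → A) (g : Fin n → B) →
    length (filter P? (cartesianProduct (tabulate f) (tabulate g))) ≡ ∑[ i < m ] ∑[ j < n ] 𝟙[ P? (f i , g j) ]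
  length-filter-cartesianProduct-tabulate {zero} f g = refl
  length-filter-cartesianProduct-tabulate {suc m} {n} f g = begin
    length (filter P? (row ++ rest))                   ≡⟨ cong length (filter-++ P? row rest) ⟩
    length (filter P? row ++ filter P? rest)           ≡⟨ length-++ (filter P? row) ⟩
    length (filter P? row) + length (filter P? rest)   ≡⟨ cong₂ _+_ rowCount (length-filter-cartesianProduct-tabulate (f ∘ F.suc) g) ⟩
    ∑[ i < suc m ] ∑[ j < n ] 𝟙[ P? (f i , g j) ]      ∎
    where
    row : List (A × B)
    row = map (f F.zero ,_) (tabulate g)
    rest : List (A × B)
    rest = cartesianProduct (tabulate (f ∘ F.suc)) (tabulate g)
    rowCount : length (filter P? row) ≡ ∑[ j < n ] 𝟙[ P? (f F.zero , g j) ]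
    rowCount = trans (cong (length ∘ filter P?) (map-tabulate g (f F.zero ,_))) (length-filter-tabulate P? {n} _)

NonInversionAcross : ∀ {n} → Permutation′ n → ℕ → Fin n → Fin n → Set
NonInversionAcross σ c a b = toℕ a < c × c ≤ toℕ b × σ ⟨$⟩ʳ a F.< σ ⟨$⟩ʳ b

nonInversionAcross? : ∀ {n} (σ : Permutation′ n) c a b → Dec (NonInversionAcross σ c a b)
nonInversionAcross? σ c a b = (toℕ a <? c) ×-dec ((c ≤? toℕ b) ×-dec ((σ ⟨$⟩ʳ a) F.<? (σ ⟨$⟩ʳ b)))

zoneCrossing≡∑∑ : ∀ {n} (σ : Permutation′ n) c → zoneCrossing σ c ≡ ∑[ a < n ] ∑[ b < n ] 𝟙[ nonInversionAcross? σ c a b ]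
zoneCrossing≡∑∑ {n} σ c = length-filter-cartesianProduct-tabulate _ {n} {n} (λ a → a) (λ b → b)

zoneCrossing-0 : ∀ {n} (σ : Permutation′ n) → zoneCrossing σ 0 ≡ 0
zoneCrossing-0 {n} σ = trans (zoneCrossing≡∑∑ σ 0)
  (sum-zero {n} _ λ a → sum-zero {n} _ λ b → 𝟙-reject (nonInversionAcross? σ 0 a b) λ ())

zoneCrossing-n : ∀ {n} (σ : Permutation′ n) → zoneCrossing σ n ≡ 0
zoneCrossing-n {n} σ = trans (zoneCrossing≡∑∑ σ n)
  (sum-zero {n} _ λ a → sum-zero {n} _ λ b → 𝟙-reject (nonInversionAcross? σ n a b)
    λ (_ , n≤b , _) → ≤⇒≯ n≤b (toℕ<n b))

augmented≡applyUpTo : ∀ {n} (σ : Permutation′ n) → augmented σ ≡ applyUpTo (zoneCrossing σ) (suc n)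
augmented≡applyUpTo {n} σ = trans (map-cong atBoundary (upTo (suc n))) (map-upTo (zoneCrossing σ) (suc n))
  where
  atBoundary : ∀ i → (if ⌊ (i ≟ 0) ⊎-dec (i ≟ n) ⌋ then 0 else zoneCrossing σ i) ≡ zoneCrossing σ i
  atBoundary i with i ≟ 0 | i ≟ n
  ... | yes refl | _        = sym (zoneCrossing-0 σ)
  ... | no _     | yes refl = sym (zoneCrossing-n σ)
  ... | no _     | no _     = refl

toℕ-punchIn-< : ∀ {n} (k : Fin (suc n)) (t : Fin n) → toℕ t < toℕ k → toℕ (punchIn k t) ≡ toℕ t
toℕ-punchIn-< (F.suc k) F.zero    _          = refl
toℕ-punchIn-< (F.suc k) (F.suc t) (s<s t<k) = cong suc (toℕ-punchIn-< k t t<k)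

toℕ-punchIn-≥ : ∀ {n} (k : Fin (suc n)) (t : Fin n) → toℕ k ≤ toℕ t → toℕ (punchIn k t) ≡ suc (toℕ t)
toℕ-punchIn-≥ F.zero    t         _          = refl
toℕ-punchIn-≥ (F.suc k) (F.suc t) (s≤s k≤t) = cong suc (toℕ-punchIn-≥ k t k≤t)

<⇔<⇒≥⇔≥ : ∀ {p c q d} → (p < c ⇔ q < d) → (c ≤ p ⇔ d ≤ q)
<⇔<⇒≥⇔≥ p<c⇔q<d = mk⇔
  (λ c≤p → ≮⇒≥ λ q<d → ≤⇒≯ c≤p (Equivalence.from p<c⇔q<d q<d))
  (λ d≤q → ≮⇒≥ λ p<c → ≤⇒≯ d≤q (Equivalence.to p<c⇔q<d p<c))

module _ {n} (k : Fin (suc n)) where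

  punchIn-<-cut : ∀ c (t : Fin n) → c ≤ toℕ k → (toℕ (punchIn k t) < c ⇔ toℕ t < c)
  punchIn-<-cut c t c≤k with toℕ t <? toℕ k
  ... | yes t<k rewrite toℕ-punchIn-< k t t<k = ⇔.refl
  ... | no t≮k rewrite toℕ-punchIn-≥ k t (≮⇒≥ t≮k) = mk⇔
    (λ 1+t<c → contradiction (≤-trans (n≤1+n _) 1+t<c) t≮c)
    (λ t<c → contradiction t<c t≮c)
    where
    t≮c : ¬ toℕ t < c
    t≮c = ≤⇒≯ (≤-trans c≤k (≮⇒≥ t≮k))

  punchIn-<-suc-cut : ∀ c (t : Fin n) → toℕ k ≤ c → (toℕ (punchIn k t) < suc c ⇔ toℕ t < c)
  punchIn-<-suc-cut c t k≤c with toℕ t <? toℕ k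
  ... | yes t<k rewrite toℕ-punchIn-< k t t<k = mk⇔ (λ _ → <-≤-trans t<k k≤c) m<n⇒m<1+n
  ... | no t≮k rewrite toℕ-punchIn-≥ k t (≮⇒≥ t≮k) = mk⇔ s<s⁻¹ s<s

module _ {n} (k : Fin (suc n)) (π : Permutation′ n) where

  toℕ-insertMax-k : toℕ (insertMax k π ⟨$⟩ʳ k) ≡ n
  toℕ-insertMax-k with k F.≟ k
  ... | yes _   = toℕ-fromℕ n
  ... | no k≢k = contradiction refl k≢k

  toℕ-insertMax-punchIn : ∀ t → toℕ (insertMax k π ⟨$⟩ʳ punchIn k t) ≡ toℕ (π ⟨$⟩ʳ t)
  toℕ-insertMax-punchIn t = trans (cong toℕ (insert-punchIn k (fromℕ n) π t))
    (toℕ-punchIn-< (fromℕ n) (π ⟨$⟩ʳ t) (subst (toℕ (π ⟨$⟩ʳ t) <_) (sym (toℕ-fromℕ n)) (toℕ<n _)))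

  insertMax-punchIn-< : ∀ x y →
    (insertMax k π ⟨$⟩ʳ punchIn k x F.< insertMax k π ⟨$⟩ʳ punchIn k y) ⇔ (π ⟨$⟩ʳ x F.< π ⟨$⟩ʳ y)
  insertMax-punchIn-< x y rewrite toℕ-insertMax-punchIn x | toℕ-insertMax-punchIn y = ⇔.refl

  insertMax-punchIn-<-k : ∀ x → insertMax k π ⟨$⟩ʳ punchIn k x F.< insertMax k π ⟨$⟩ʳ k
  insertMax-punchIn-<-k x rewrite toℕ-insertMax-punchIn x | toℕ-insertMax-k = toℕ<n (π ⟨$⟩ʳ x)

  insertMax-k-≮ : ∀ b → ¬ (insertMax k π ⟨$⟩ʳ k F.< insertMax k π ⟨$⟩ʳ b)
  insertMax-k-≮ b k<b = ≤⇒≯ (s≤s⁻¹ (toℕ<n (insertMax k π ⟨$⟩ʳ b))) (subst (_< toℕ (insertMax k π ⟨$⟩ʳ b)) toℕ-insertMax-k k<b)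

  private
    ρ : Permutation′ (suc n)
    ρ = insertMax k π

    N? : ∀ {m} (σ : Permutation′ m) c a b → Dec (NonInversionAcross σ c a b)
    N? = nonInversionAcross?

  ∑∑-insertMax : ∀ c → ∑[ a < suc n ] ∑[ b < suc n ] 𝟙[ N? ρ c a b ]
    ≡ ∑[ x < n ] 𝟙[ N? ρ c (punchIn k x) k ] + ∑[ x < n ] ∑[ y < n ] 𝟙[ N? ρ c (punchIn k x) (punchIn k y) ]
  ∑∑-insertMax c = begin
    ∑[ a < suc n ] ∑[ b < suc n ] 𝟙[ N? ρ c a b ]
      ≡⟨ sum-remove {n} {k} (λ a → ∑[ b < suc n ] 𝟙[ N? ρ c a b ]) ⟩
    ∑[ b < suc n ] 𝟙[ N? ρ c k b ] + ∑[ x < n ] ∑[ b < suc n ] 𝟙[ N? ρ c (punchIn k x) b ]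
      ≡⟨ cong₂ _+_ (sum-zero {suc n} _ λ b → 𝟙-reject (N? ρ c k b) λ (_ , _ , k<b) → insertMax-k-≮ b k<b)
                   (sum-cong-≗ {n} λ x → sum-remove {n} {k} (λ b → 𝟙[ N? ρ c (punchIn k x) b ])) ⟩
    ∑[ x < n ] (𝟙[ N? ρ c (punchIn k x) k ] + ∑[ y < n ] 𝟙[ N? ρ c (punchIn k x) (punchIn k y) ])
      ≡⟨ ∑-distrib-+ {n} _ _ ⟩
    ∑[ x < n ] 𝟙[ N? ρ c (punchIn k x) k ] + ∑[ x < n ] ∑[ y < n ] 𝟙[ N? ρ c (punchIn k x) (punchIn k y) ]
      ∎

  zoneCrossing-insertMax-≤ : ∀ c → c ≤ toℕ k → zoneCrossing ρ c ≡ zoneCrossing π c + c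
  zoneCrossing-insertMax-≤ c c≤k = begin
    zoneCrossing ρ c
      ≡⟨ trans (zoneCrossing≡∑∑ ρ c) (∑∑-insertMax c) ⟩
    ∑[ x < n ] 𝟙[ N? ρ c (punchIn k x) k ] + ∑[ x < n ] ∑[ y < n ] 𝟙[ N? ρ c (punchIn k x) (punchIn k y) ]
      ≡⟨ cong₂ _+_ (sum-cong-≗ {n} λ x → 𝟙-⇔ (toNewEntry x) (N? ρ c (punchIn k x) k) (toℕ x <? c))
                   (sum-cong-≗ {n} λ x → sum-cong-≗ {n} λ y → 𝟙-⇔ (oldPairs x y) (N? ρ c (punchIn k x) (punchIn k y)) (N? π c x y)) ⟩
    ∑[ x < n ] 𝟙[ toℕ x <? c ] + ∑[ x < n ] ∑[ y < n ] 𝟙[ N? π c x y ]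
      ≡⟨ cong₂ _+_ (∑-𝟙-toℕ< c (≤-trans c≤k (s≤s⁻¹ (toℕ<n k)))) (sym (zoneCrossing≡∑∑ π c)) ⟩
    c + zoneCrossing π c
      ≡⟨ +-comm c _ ⟩
    zoneCrossing π c + c
      ∎
    where
    oldPairs : ∀ x y → NonInversionAcross ρ c (punchIn k x) (punchIn k y) ⇔ NonInversionAcross π c x y
    oldPairs x y = punchIn-<-cut k c x c≤k ×-⇔ <⇔<⇒≥⇔≥ (punchIn-<-cut k c y c≤k) ×-⇔ insertMax-punchIn-< x y
    toNewEntry : ∀ x → NonInversionAcross ρ c (punchIn k x) k ⇔ toℕ x < c
    toNewEntry x = mk⇔ (λ (x<c , _) → Equivalence.to (punchIn-<-cut k c x c≤k) x<c)
      (λ x<c → Equivalence.from (punchIn-<-cut k c x c≤k) x<c , c≤k , insertMax-punchIn-<-k x)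

  zoneCrossing-insertMax-≥ : ∀ c → toℕ k ≤ c → zoneCrossing ρ (suc c) ≡ zoneCrossing π c
  zoneCrossing-insertMax-≥ c k≤c = begin
    zoneCrossing ρ (suc c)
      ≡⟨ trans (zoneCrossing≡∑∑ ρ (suc c)) (∑∑-insertMax (suc c)) ⟩
    ∑[ x < n ] 𝟙[ N? ρ (suc c) (punchIn k x) k ] + ∑[ x < n ] ∑[ y < n ] 𝟙[ N? ρ (suc c) (punchIn k x) (punchIn k y) ]
      ≡⟨ cong₂ _+_ (sum-zero {n} _ λ x → 𝟙-reject (N? ρ (suc c) (punchIn k x) k) λ (_ , c<k , _) → ≤⇒≯ k≤c c<k)
                   (sum-cong-≗ {n} λ x → sum-cong-≗ {n} λ y → 𝟙-⇔ (oldPairs x y) (N? ρ (suc c) (punchIn k x) (punchIn k y)) (N? π c x y)) ⟩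
    ∑[ x < n ] ∑[ y < n ] 𝟙[ N? π c x y ]
      ≡⟨ sym (zoneCrossing≡∑∑ π c) ⟩
    zoneCrossing π c
      ∎
    where
    oldPairs : ∀ x y → NonInversionAcross ρ (suc c) (punchIn k x) (punchIn k y) ⇔ NonInversionAcross π c x y
    oldPairs x y = punchIn-<-suc-cut k c x k≤c ×-⇔ <⇔<⇒≥⇔≥ (punchIn-<-suc-cut k c y k≤c) ×-⇔ insertMax-punchIn-< x y

applyUpTo-cong : ∀ {a} {A : Set a} {f g : ℕ → A} → (∀ i → f i ≡ g i) → ∀ m → applyUpTo f m ≡ applyUpTo g m
applyUpTo-cong f≗g zero    = refl
applyUpTo-cong f≗g (suc m) = cong₂ _∷_ (f≗g 0) (applyUpTo-cong (f≗g ∘ suc) m)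

applyUpTo-insert : ∀ K m (f g h : ℕ → ℕ) → K ≤ m →
  (∀ i → i ≤ K → g i ≡ f i + h i) → (∀ j → K ≤ j → g (suc j) ≡ f j) →
  applyUpTo g (suc (suc m)) ≡ zipWith _+_ (take (suc K) (applyUpTo f (suc m))) (applyUpTo h (suc K)) ++ drop K (applyUpTo f (suc m))
applyUpTo-insert zero m f g h _ below above =
  cong₂ _∷_ (below 0 z≤n) (applyUpTo-cong (λ j → above j z≤n) (suc m))
applyUpTo-insert (suc K) (suc m) f g h (s≤s K≤m) below above =
  cong₂ _∷_ (below 0 z≤n)
    (applyUpTo-insert K m (f ∘ suc) (g ∘ suc) (h ∘ suc) K≤m (λ i i≤K → below (suc i) (s≤s i≤K)) (λ j K≤j → above (suc j) (s≤s K≤j)))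

lemma3p6 : (n : ℕ) (π : Permutation′ n) (k : Fin (suc n)) →
    augmented (insertMax k π)
      ≡ zipWith _+_ (take (suc (toℕ k)) (augmented π)) (upTo (suc (toℕ k)))
          ++ drop (toℕ k) (augmented π)
lemma3p6 n π k = begin
  augmented (insertMax k π)
    ≡⟨ augmented≡applyUpTo (insertMax k π) ⟩
  applyUpTo (zoneCrossing (insertMax k π)) (suc (suc n))
    ≡⟨ applyUpTo-insert (toℕ k) n (zoneCrossing π) (zoneCrossing (insertMax k π)) (λ i → i) (s≤s⁻¹ (toℕ<n k))
         (zoneCrossing-insertMax-≤ k π) (zoneCrossing-insertMax-≥ k π) ⟩
  zipWith _+_ (take (suc (toℕ k)) zs) (upTo (suc (toℕ k))) ++ drop (toℕ k) zs
    ≡⟨ cong (λ v → zipWith _+_ (take (suc (toℕ k)) v) (upTo (suc (toℕ k))) ++ drop (toℕ k) v) (sym (augmented≡applyUpTo π)) ⟩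
  zipWith _+_ (take (suc (toℕ k)) (augmented π)) (upTo (suc (toℕ k))) ++ drop (toℕ k) (augmented π)
    ∎
  where
  zs : List ℕ
  zs = applyUpTo (zoneCrossing π) (suc n)
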